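{- Let $\mathcal I$ be an ideal information model whose canonical semantic representative (semantic state set) is the finite knowledge base $S_O\subseteq\mathbb S_O$. Define the semantic atomicity $\mathsf A(\mathcal I):=|\mathrm{Atom}(S_O)|$, the maximum intrinsic derivation depth $\mathsf{D_d}(\mathcal I):=\max_{q\in S_O}\mathrm{Dd}(q\mid \mathrm{Atom}(S_O))$ (with $\max\varnothing:=0$), and for $q\in S_O$ the intrinsic and operational depths $n_{\mathrm{int}}(q):=\mathrm{Dd}(q\mid\mathrm{Atom}(S_O))$, $n_{\mathrm{op}}(q):=\mathrm{Dd}(q\mid S_O)$. Then: (i) $\mathsf A(\mathcal I)$ and $\mathsf{D_d}(\mathcal I)$ are uniquely determined by $S_O$ and the fixed canonical order; (ii) both are finite non-negative integers computable from $S_O$; (iii) for every $q\in S_O$, $n_{\mathrm{op}}(q)\le n_{\mathrm{int}}(q)\le \mathsf{D_d}(\mathcal I)$; (iv) $\mathsf{D_d}(\mathcal I)=0$ if and only if $\mathrm{Atom}(S_O)=S_O$.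
   Context: Fix a countable ambient semantic universe $\mathbb S_O$, whose elements are identified with ground atoms of a fixed inference fragment equipped with a fixed effective proof system $\mathsf{PS}$ (proof checking decidable). For $\Gamma\subseteq\mathbb S_O$, $\mathrm{Cn}(\Gamma)$ is the set of formulas derivable from $\Gamma$; it satisfies reflexivity ($\Gamma\subseteq\mathrm{Cn}(\Gamma)$), monotonicity ($\Gamma\subseteq\Gamma'\Rightarrow \mathrm{Cn}(\Gamma)\subseteq\mathrm{Cn}(\Gamma')$) and idempotence ($\mathrm{Cn}(\mathrm{Cn}(\Gamma))=\mathrm{Cn}(\Gamma)$). The immediate consequence operator is $T(\Gamma):=\Gamma\cup\{s\in\mathbb S_O: s \text{ is derivable from }\Gamma\text{ by exactly one inference step}\}$, with $T^0(\Gamma)=\Gamma$, $T^{n+1}(\Gamma)=T(T^n(\Gamma))$. It is assumed that: $T$ is monotone; for finite $\Gamma$, $T(\Gamma)$ is finite and effectively computable; $\mathrm{Cn}(\Gamma)=\bigcup_{n\ge0}T^n(\Gamma)$ for finite $\Gamma$; and for finite $\Gamma$ the chain $T^n(\Gamma)$ stabilizes after finitely many steps at $\mathrm{Cn}(\Gamma)$. Knowledge bases are finite subsets of $\mathbb S_O$, effectively listable in a fixed canonical order, and the predicate $s\in\mathrm{Cn}(\Gamma)$ is decidable for finite $\Gamma\subseteq S_O$, $s\in S_O$. $\mathrm{Atom}(S_O)$ (irredundant core) is the output of: initialize $A\gets S_O$; scan the elements $s$ of $S_O$ in the canonical order and, if $s\in\mathrm{Cn}(A\setminus\{s\})$, set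 $A\gets A\setminus\{s\}$; output $A$. For finite $B\subseteq\mathbb S_O$ and $s\in\mathbb S_O$, the derivation depth is $\mathrm{Dd}(s\mid B):=\min\{n\ge0: s\in T^n(B)\}$, and $\mathrm{Dd}(s\mid B):=\infty$ if $s\notin\mathrm{Cn}(B)$. An information model consists of a semantic state set $S_O$, a carrier state set $S_C$ (finite sets of object–time states) and an enabling relation; it is ideal if there is a definable, time-order-preserving bijection $\tau:S_O\to S_C$ (a synonymy witness) and the enabling map is singleton-valued, $\mathcal E(s)=\{\tau(s)\}$; then $S_O$ is taken as its canonical semantic representative. -}

module Defs where

open import Data.Nat using (ℕ; zero; suc; _≤_; _<_)
open import Data.List using (List; []; _∷_; filter; length)
open import Data.List.Membership.Propositional using (_∈_; _∉_)
open import Data.List.Relation.Binary.Subset.Propositional using (_⊆_)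
open import Data.List.Relation.Unary.AllPairs using (AllPairs)
open import Data.Product using (Σ; ∃; _×_; _,_)
open import Data.Sum using (_⊎_)
open import Relation.Binary.PropositionalEquality using (_≡_)
open import Relation.Binary.Core using (Rel)
open import Relation.Binary.Structures using (IsStrictTotalOrder)
open import Relation.Nullary using (Dec; yes; no; ¬?)
open import Function.Definitions using (Injective)

pow : {A : Set} → (A → A) → ℕ → A → A
pow f zero    x = x
pow f (suc n) x = f (pow f n x)

-- Abstract setting: countable ambient universe U of ground atoms with a
-- fixed canonical (strict total) order, immediate-consequence operator T
-- acting on finite sets (represented as lists), and Cn Γ = ⋃ₙ Tⁿ(Γ).
record InfSys : Set₁ where
  field
    U           : Set
    enc         : U → ℕ
    enc-inj     : Injective _≡_ _≡_ enc
    _<ᶜ_        : Rel U _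
    canonical   : IsStrictTotalOrder _≡_ _<ᶜ_
    T           : List U → List U
    T-incl      : ∀ Γ → Γ ⊆ T Γ
    T-mono      : ∀ {Γ Γ'} → Γ ⊆ Γ' → T Γ ⊆ T Γ'
    T-stab      : ∀ Γ → ∃ λ N → T (pow T N Γ) ⊆ pow T N Γ
    Cn?         : ∀ Γ s → Dec (∃ λ n → s ∈ pow T n Γ)

  Cn : List U → U → Set
  Cn Γ s = ∃ λ n → s ∈ pow T n Γ

  open IsStrictTotalOrder canonical using (_≟_)

  -- a knowledge base: a finite subset of U, listed in canonical order
  Canonical : List U → Set
  Canonical S = AllPairs _<ᶜ_ S

  _≈ˢ_ : List U → List U → Set
  S ≈ˢ S' = (S ⊆ S') × (S' ⊆ S)

  remove : U → List U → List U
  remove s A = filter (λ x → ¬? (x ≟ s)) A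

  atomScan : List U → List U → List U
  atomScan A []       = A
  atomScan A (s ∷ ss) with Cn? (remove s A) s
  ... | yes _ = atomScan (remove s A) ss
  ... | no  _ = atomScan A ss

  Atom : List U → List U
  Atom S = atomScan S S

  atomicity : List U → ℕ
  atomicity S = length (Atom S)

  data ℕ∞ : Set where
    fin : ℕ → ℕ∞
    ∞   : ℕ∞

  data _≤∞_ : ℕ∞ → ℕ∞ → Set where
    fin≤fin : ∀ {m n} → m ≤ n → fin m ≤∞ fin n
    _≤∞∞    : ∀ x → x ≤∞ ∞

  IsDd : List U → U → ℕ∞ → Set
  IsDd B s (fin n) = s ∈ pow T n B × (∀ m → m < n → s ∉ pow T m B)
  IsDd B s ∞       = ∀ n → s ∉ pow T n B

  IsMaxDd : List U → ℕ∞ → Set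
  IsMaxDd S d =
    (∀ q → q ∈ S → Σ ℕ∞ λ e → IsDd (Atom S) q e × e ≤∞ d)
    × (d ≡ fin 0 ⊎ Σ U λ q → q ∈ S × IsDd (Atom S) q d)

-- Removing s from A when s ∈ Cn(A ∖ {s}) does not change Cn(A), so the scan
-- computing Atom(S) keeps Cn(S) and every q ∈ S has a finite intrinsic depth;
-- the maximum of finitely many such depths is a finite D_d. Since
-- Atom(S) ⊆ S, depths over S are at most depths over Atom(S). D_d = 0 means
-- S ⊆ T⁰(Atom S) = Atom S. Finally a finite set has only one strictly
-- increasing listing, which makes everything depend on the set S alone.
module Submission where

open import Defs
open import Data.Nat using (ℕ; zero; suc; _+_; _≤_; _<_; z≤n)
open import Data.Nat.Induction using (<-wellFounded)
open import Data.Nat.Properties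
  using (≤-refl; ≤-trans; ≤-antisym; ≤-total; ≮⇒≥; <-cmp; anyUpTo?)
open import Data.List using (List; []; _∷_)
open import Data.List.Membership.Propositional using (_∈_)
open import Data.List.Membership.Propositional.Properties using (∈-filter⁺; ∈-filter⁻)
open import Data.List.Relation.Binary.Subset.Propositional using (_⊆_)
open import Data.List.Relation.Unary.Any using (here; there)
import Data.List.Relation.Unary.All as All
open import Data.List.Relation.Unary.AllPairs using (AllPairs; []; _∷_)
import Data.List.Relation.Unary.AllPairs.Properties as AllPairsₚ
open import Data.Product using (Σ; _×_; _,_; proj₁; proj₂)
open import Data.Sum using (_⊎_; inj₁; inj₂)
open import Data.Empty using (⊥-elim)
open import Induction.WellFounded using (Acc; acc)
open import Relation.Nullary using (yes; no; ¬_; ¬?)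
open import Relation.Unary using (Pred; Decidable)
open import Relation.Binary.Core using (Rel)
open import Relation.Binary.Definitions using (Irreflexive; Asymmetric; tri<; tri≈; tri>)
open import Relation.Binary.PropositionalEquality using (_≡_; refl; sym; cong; subst)
open import Relation.Binary.Structures using (IsStrictTotalOrder)
open import Function.Bundles using (_⇔_; mk⇔)

least-witness : ∀ {p} {P : Pred ℕ p} → Decidable P →
                ∀ k → P k → Σ ℕ λ n → P n × (∀ m → m < n → ¬ P m)
least-witness {P = P} P? k pk = go k pk (<-wellFounded k)
  where
  go : ∀ k → P k → Acc _<_ k → Σ ℕ λ n → P n × (∀ m → m < n → ¬ P m)
  go k pk (acc rs) with anyUpTo? P? k
  ... | no  none-below     = k , pk , λ m m<k pm → none-below (m , m<k , pm)
  ... | yes (n , n<k , pn) = go n pn (rs n<k)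

module _ {a ℓ} {A : Set a} {_<_ : Rel A ℓ} (irrefl : Irreflexive _≡_ _<_) (asym : Asymmetric _<_) where

  strictly-sorted-⊆-antisym : ∀ {xs ys} → AllPairs _<_ xs → AllPairs _<_ ys →
                              xs ⊆ ys → ys ⊆ xs → xs ≡ ys
  strictly-sorted-⊆-antisym {[]}    {[]}    _ _ _ _ = refl
  strictly-sorted-⊆-antisym {[]}    {y ∷ _} _ _ _ ys⊆xs with ys⊆xs (here refl)
  ... | ()
  strictly-sorted-⊆-antisym {x ∷ _} {[]}    _ _ xs⊆ys _ with xs⊆ys (here refl)
  ... | ()
  strictly-sorted-⊆-antisym {x ∷ xs} {y ∷ ys} (x< ∷ sxs) (y< ∷ sys) xs⊆ys ys⊆xs
    with heads-equal
    where
    heads-equal : x ≡ y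
    heads-equal with xs⊆ys (here refl) | ys⊆xs (here refl)
    ... | here x≡y    | _          = x≡y
    ... | there _     | here y≡x   = sym y≡x
    ... | there x∈ys  | there y∈xs = ⊥-elim (asym (All.lookup x< y∈xs) (All.lookup y< x∈ys))
  ... | refl = cong (x ∷_) (strictly-sorted-⊆-antisym sxs sys (tails x< xs⊆ys) (tails y< ys⊆xs))
    where
    tails : ∀ {zs ws} → All.All (x <_) zs → x ∷ zs ⊆ x ∷ ws → zs ⊆ ws
    tails x<zs zs⊆ws z∈zs with zs⊆ws (there z∈zs)
    ... | here refl  = ⊥-elim (irrefl refl (All.lookup x<zs z∈zs))
    ... | there z∈ws = z∈ws

module ℕ∞-Order (𝓘 : InfSys) where
  open InfSys 𝓘 using (ℕ∞; fin; ∞; _≤∞_; fin≤fin; _≤∞∞)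

  fin-injective : ∀ {m n} → fin m ≡ fin n → m ≡ n
  fin-injective refl = refl

  fin≤fin⁻ : ∀ {m n} → fin m ≤∞ fin n → m ≤ n
  fin≤fin⁻ (fin≤fin m≤n) = m≤n

  ≤∞-trans : ∀ {x y z} → x ≤∞ y → y ≤∞ z → x ≤∞ z
  ≤∞-trans (fin≤fin m≤n) (fin≤fin n≤o) = fin≤fin (≤-trans m≤n n≤o)
  ≤∞-trans {x} _ (_ ≤∞∞) = x ≤∞∞

  ≤∞-antisym : ∀ {x y} → x ≤∞ y → y ≤∞ x → x ≡ y
  ≤∞-antisym (fin≤fin m≤n) (fin≤fin n≤m) = cong fin (≤-antisym m≤n n≤m)
  ≤∞-antisym (.∞ ≤∞∞) (.∞ ≤∞∞) = refl

  fin0≤∞ : ∀ x → fin 0 ≤∞ x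
  fin0≤∞ (fin n) = fin≤fin z≤n
  fin0≤∞ ∞       = fin 0 ≤∞∞

module Development (𝓘 : InfSys) where
  open InfSys 𝓘
  open ℕ∞-Order 𝓘
  open IsStrictTotalOrder canonical using (_≟_; irrefl; asym)
  open import Data.List.Membership.DecPropositional _≟_ using (_∈?_)

  pow-mono : ∀ n {Γ Γ'} → Γ ⊆ Γ' → pow T n Γ ⊆ pow T n Γ'
  pow-mono zero    Γ⊆Γ' = Γ⊆Γ'
  pow-mono (suc n) Γ⊆Γ' = T-mono (pow-mono n Γ⊆Γ')

  pow-inflationary : ∀ n {Γ} → Γ ⊆ pow T n Γ
  pow-inflationary zero    x∈ = x∈
  pow-inflationary (suc n) x∈ = T-incl _ (pow-inflationary n x∈)

  pow-+ : ∀ n k Γ → pow T n (pow T k Γ) ≡ pow T (n + k) Γ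
  pow-+ zero    k Γ = refl
  pow-+ (suc n) k Γ = cong T (pow-+ n k Γ)

  Cn-cut : ∀ {A B k x} → A ⊆ pow T k B → Cn A x → Cn B x
  Cn-cut {A} {B} {k} {x} A⊆ (n , x∈) =
    n + k , subst (x ∈_) (pow-+ n k B) (pow-mono n A⊆ x∈)

  remove-⊆ : ∀ s A → remove s A ⊆ A
  remove-⊆ s A x∈ = proj₁ (∈-filter⁻ (λ x → ¬? (x ≟ s)) {xs = A} x∈)

  ∈-remove⁺ : ∀ {s x A} → x ∈ A → ¬ x ≡ s → x ∈ remove s A
  ∈-remove⁺ {s} x∈A x≢s = ∈-filter⁺ (λ x → ¬? (x ≟ s)) x∈A x≢s

  remove-derivable : ∀ {s A x} → Cn (remove s A) s → Cn A x → Cn (remove s A) x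
  remove-derivable {s} {A} (k , s∈) = Cn-cut {k = k} A⊆
    where
    A⊆ : A ⊆ pow T k (remove s A)
    A⊆ {a} a∈A with a ≟ s
    ... | yes refl = s∈
    ... | no  a≢s  = pow-inflationary k (∈-remove⁺ a∈A a≢s)

  atomScan-Cn : ∀ A ss {x} → Cn A x → Cn (atomScan A ss) x
  atomScan-Cn A []       cx = cx
  atomScan-Cn A (s ∷ ss) cx with Cn? (remove s A) s
  ... | yes cs = atomScan-Cn (remove s A) ss (remove-derivable cs cx)
  ... | no  _  = atomScan-Cn A ss cx

  atomScan-⊆ : ∀ A ss → atomScan A ss ⊆ A
  atomScan-⊆ A []       x∈ = x∈
  atomScan-⊆ A (s ∷ ss) x∈ with Cn? (remove s A) s
  ... | yes _ = remove-⊆ s A (atomScan-⊆ (remove s A) ss x∈)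
  ... | no  _ = atomScan-⊆ A ss x∈

  atomScan-canonical : ∀ {A} ss → Canonical A → Canonical (atomScan A ss)
  atomScan-canonical     []       cA = cA
  atomScan-canonical {A} (s ∷ ss) cA with Cn? (remove s A) s
  ... | yes _ = atomScan-canonical ss (AllPairsₚ.filter⁺ (λ x → ¬? (x ≟ s)) cA)
  ... | no  _ = atomScan-canonical ss cA

  Atom-⊆ : ∀ S → Atom S ⊆ S
  Atom-⊆ S = atomScan-⊆ S S

  Atom-Cn : ∀ {S q} → q ∈ S → Cn (Atom S) q
  Atom-Cn {S} q∈S = atomScan-Cn S S (0 , q∈S)

  canonical-⊆-antisym : ∀ {S S'} → Canonical S → Canonical S' → S ⊆ S' → S' ⊆ S → S ≡ S'
  canonical-⊆-antisym = strictly-sorted-⊆-antisym irrefl asym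

  IsDd-exists : ∀ {B q} → Cn B q → Σ ℕ λ n → IsDd B q (fin n)
  IsDd-exists {B} {q} (k , q∈) = least-witness (λ n → q ∈? pow T n B) k q∈

  IsDd-unique : ∀ {B q x y} → IsDd B q x → IsDd B q y → x ≡ y
  IsDd-unique {x = fin n} {fin m} (q∈n , below-n) (q∈m , below-m) with <-cmp n m
  ... | tri< n<m _ _ = ⊥-elim (below-m n n<m q∈n)
  ... | tri≈ _ n≡m _ = cong fin n≡m
  ... | tri> _ _ m<n = ⊥-elim (below-n m m<n q∈m)
  IsDd-unique {x = fin n} {∞}     (q∈n , _) never = ⊥-elim (never n q∈n)
  IsDd-unique {x = ∞}     {fin m} never (q∈m , _) = ⊥-elim (never m q∈m)
  IsDd-unique {x = ∞}     {∞}     _ _ = refl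

  IsDd-antitone : ∀ {B B' q m n} → B ⊆ B' → IsDd B q (fin n) → IsDd B' q (fin m) → m ≤ n
  IsDd-antitone {n = n} B⊆B' (q∈ , _) (_ , below-m) =
    ≮⇒≥ λ n<m → below-m n n<m (pow-mono n B⊆B' q∈)

  -- IsMaxDd S d is IsMaxDdOver (Atom S) S d, with the list of queries made a parameter.
  IsMaxDdOver : List U → List U → ℕ∞ → Set
  IsMaxDdOver B L d =
    (∀ q → q ∈ L → Σ ℕ∞ λ e → IsDd B q e × e ≤∞ d)
    × (d ≡ fin 0 ⊎ Σ U λ q → q ∈ L × IsDd B q d)

  IsMaxDdOver-bound : ∀ {B L q n d} → IsMaxDdOver B L (fin d) →
                      q ∈ L → IsDd B q (fin n) → n ≤ d
  IsMaxDdOver-bound (bounded , _) q∈L dd with bounded _ q∈L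
  ... | e , dd' , e≤d with IsDd-unique dd dd'
  ...   | refl = fin≤fin⁻ e≤d

  IsMaxDdOver-unique : ∀ {B L d e} → IsMaxDdOver B L d → IsMaxDdOver B L e → d ≡ e
  IsMaxDdOver-unique {d = d} {e} (d-bounds , d-attained) (e-bounds , e-attained) =
    ≤∞-antisym (attained-below d-attained e-bounds) (attained-below e-attained d-bounds)
    where
    attained-below : ∀ {B L x y} → (x ≡ fin 0 ⊎ Σ U λ q → q ∈ L × IsDd B q x) →
                     (∀ q → q ∈ L → Σ ℕ∞ λ e → IsDd B q e × e ≤∞ y) → x ≤∞ y
    attained-below {y = y} (inj₁ refl) _ = fin0≤∞ y
    attained-below (inj₂ (q , q∈L , dd)) bounds with bounds q q∈L
    ... | e , dd' , e≤y = subst (_≤∞ _) (IsDd-unique dd' dd) e≤y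

  IsMaxDdOver-∷ : ∀ {B x L n d} → IsDd B x (fin n) → IsMaxDdOver B L (fin d) →
                  Σ ℕ λ d' → IsMaxDdOver B (x ∷ L) (fin d')
  IsMaxDdOver-∷ {n = n} {d} ddx (bounds , attained) with ≤-total n d
  ... | inj₁ n≤d = d , bounds′ , extend attained
    where
    bounds′ : ∀ q → q ∈ _ ∷ _ → Σ ℕ∞ λ e → IsDd _ q e × e ≤∞ fin d
    bounds′ q (here refl) = fin n , ddx , fin≤fin n≤d
    bounds′ q (there q∈L) = bounds q q∈L
    extend : ∀ {B x L} → (fin d ≡ fin 0 ⊎ Σ U λ q → q ∈ L × IsDd B q (fin d)) →
             fin d ≡ fin 0 ⊎ Σ U λ q → q ∈ x ∷ L × IsDd B q (fin d)
    extend (inj₁ d≡0)              = inj₁ d≡0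
    extend (inj₂ (q , q∈L , ddq))  = inj₂ (q , there q∈L , ddq)
  ... | inj₂ d≤n = n , bounds′ , inj₂ (_ , here refl , ddx)
    where
    bounds′ : ∀ q → q ∈ _ ∷ _ → Σ ℕ∞ λ e → IsDd _ q e × e ≤∞ fin n
    bounds′ q (here refl) = fin n , ddx , fin≤fin ≤-refl
    bounds′ q (there q∈L) with bounds q q∈L
    ... | e , dde , e≤d = e , dde , ≤∞-trans e≤d (fin≤fin d≤n)

  IsMaxDdOver-exists : ∀ {B} L → (∀ {q} → q ∈ L → Cn B q) → Σ ℕ λ d → IsMaxDdOver B L (fin d)
  IsMaxDdOver-exists []      _       = 0 , (λ _ ()) , inj₁ refl
  IsMaxDdOver-exists (x ∷ L) derives
    with IsDd-exists (derives (here refl)) | IsMaxDdOver-exists L (λ q∈L → derives (there q∈L))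
  ... | _ , ddx | _ , max-L = IsMaxDdOver-∷ ddx max-L

  IsMaxDdOver-zero⇒⊆ : ∀ {B L} → IsMaxDdOver B L (fin 0) → L ⊆ B
  IsMaxDdOver-zero⇒⊆ (bounds , _) q∈L with bounds _ q∈L
  ... | fin _ , (q∈B , _) , fin≤fin z≤n = q∈B

  ⊆⇒IsMaxDdOver-zero : ∀ {B L d} → L ⊆ B → IsMaxDdOver B L (fin d) → d ≡ 0
  ⊆⇒IsMaxDdOver-zero _    (_ , inj₁ d≡0) = fin-injective d≡0
  ⊆⇒IsMaxDdOver-zero L⊆B (_ , inj₂ (q , q∈L , dd)) =
    fin-injective (IsDd-unique dd (L⊆B q∈L , λ _ ()))

theorem1 : (𝓘 : InfSys) → let open InfSys 𝓘 in
    (S : List U) → Canonical S →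
    Σ ℕ λ d →
      IsMaxDd S (fin d)
      × (∀ S' → Canonical S' → S ≈ˢ S' →
           Atom S' ≡ Atom S × atomicity S' ≡ atomicity S
           × (∀ e → IsMaxDd S' e → e ≡ fin d))
      × (∀ q → q ∈ S → Σ ℕ λ nop → Σ ℕ λ nint →
           IsDd S q (fin nop) × IsDd (Atom S) q (fin nint)
           × nop ≤ nint × nint ≤ d)
      × (d ≡ 0 ⇔ Atom S ≡ S)
theorem1 𝓘 S cS = d , max-d , set-determined , depths , mk⇔ zero⇒atomic atomic⇒zero
  where
  open InfSys 𝓘
  open Development 𝓘

  d : ℕ
  d = proj₁ (IsMaxDdOver-exists S Atom-Cn)

  max-d : IsMaxDd S (fin d)
  max-d = proj₂ (IsMaxDdOver-exists S Atom-Cn)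

  set-determined : ∀ S' → Canonical S' → S ≈ˢ S' →
                   Atom S' ≡ Atom S × atomicity S' ≡ atomicity S × (∀ e → IsMaxDd S' e → e ≡ fin d)
  set-determined S' cS' (S⊆S' , S'⊆S) with canonical-⊆-antisym cS cS' S⊆S' S'⊆S
  ... | refl = refl , refl , λ e max-e → IsMaxDdOver-unique max-e max-d

  depths : ∀ q → q ∈ S → Σ ℕ λ nop → Σ ℕ λ nint →
           IsDd S q (fin nop) × IsDd (Atom S) q (fin nint) × nop ≤ nint × nint ≤ d
  depths q q∈S with IsDd-exists (Atom-Cn q∈S) | IsDd-exists {S} (0 , q∈S)
  ... | nint , dd-int | nop , dd-op =
    nop , nint , dd-op , dd-int , IsDd-antitone (Atom-⊆ S) dd-int dd-op , IsMaxDdOver-bound max-d q∈S dd-int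

  zero⇒atomic : d ≡ 0 → Atom S ≡ S
  zero⇒atomic d≡0 = canonical-⊆-antisym (atomScan-canonical S cS) cS (Atom-⊆ S)
    (IsMaxDdOver-zero⇒⊆ (subst (λ n → IsMaxDd S (fin n)) d≡0 max-d))

  atomic⇒zero : Atom S ≡ S → d ≡ 0
  atomic⇒zero Atom≡S = ⊆⇒IsMaxDdOver-zero (subst (S ⊆_) (sym Atom≡S) (λ q∈S → q∈S)) max-d
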